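{- Let $k \geq 1$, let $G$ be a minimally $k$-matchable graph, and let $x$ be a vertex of $G$ with degree $d := d_G(x) \geq 2$. Then $|\mathfrak{M}(G)| \leq \frac{d}{d-1}\cdot (k-1)$. In particular, $|\mathfrak{M}(G)| \leq 2k-2$ and the maximum degree satisfies $\Delta(G) \leq k$.
   Context: All graphs are finite and undirected; they may have multiple (parallel) edges but no loops; the degree counts edges with multiplicity. A perfect matching of a graph $G$ is a set of edges such that every vertex is an end vertex of exactly one of them; $\mathfrak{M}(G)$ denotes the set of perfect matchings of $G$. A graph $G$ is $k$-matchable if $|\mathfrak{M}(G)| \geq k$, and minimally $k$-matchable if it is $k$-matchable but $G-e$ is not $k$-matchable for every edge $e$ of $G$. -}

module Defs where

open import Data.Nat using (ℕ; zero; suc; pred)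
open import Data.Bool using (Bool; true; false; _∨_)
open import Data.Fin using (Fin; punchIn; _≟_)
open import Data.Fin.Subset using (Subset; ∣_∣; _∩_)
open import Data.Fin.Properties using (all?)
open import Data.Product using (_×_; proj₁; proj₂)
open import Data.Vec using (tabulate; _∷_; [])
open import Data.List using (List; []; _∷_; map; _++_; filter; length)
open import Relation.Nullary using (isYes; Dec)
open import Relation.Binary.PropositionalEquality using (_≡_; _≢_)
open import Data.Nat using () renaming (_≟_ to _≟ℕ_)

-- A finite loopless multigraph with vertex set Fin n and edge set Fin m;
-- each edge e has two distinct end vertices (parallel edges allowed).
record Graph (n m : ℕ) : Set where
  field
    ends     : Fin m → Fin n × Fin n
    loopless : ∀ e → proj₁ (ends e) ≢ proj₂ (ends e)
open Graph public

isEnd : ∀ {n m} → Graph n m → Fin n → Fin m → Bool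
isEnd G v e = isYes (v ≟ proj₁ (ends G e)) ∨ isYes (v ≟ proj₂ (ends G e))

incident : ∀ {n m} → Graph n m → Fin n → Subset m
incident G v = tabulate (isEnd G v)

degree : ∀ {n m} → Graph n m → Fin n → ℕ
degree G v = ∣ incident G v ∣

IsPerfectMatching : ∀ {n m} → Graph n m → Subset m → Set
IsPerfectMatching {n} G S = ∀ (v : Fin n) → ∣ S ∩ incident G v ∣ ≡ 1

isPerfectMatching? : ∀ {n m} (G : Graph n m) (S : Subset m) → Dec (IsPerfectMatching G S)
isPerfectMatching? G S = all? (λ v → ∣ S ∩ incident G v ∣ ≟ℕ 1)

allSubsets : (m : ℕ) → List (Subset m)
allSubsets zero    = [] ∷ []
allSubsets (suc m) = map (true ∷_) (allSubsets m) ++ map (false ∷_) (allSubsets m)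

numPM : ∀ {n m} → Graph n m → ℕ
numPM {m = m} G = length (filter (isPerfectMatching? G) (allSubsets m))

deleteEdge : ∀ {n m} → Graph n m → Fin m → Graph n (pred m)
deleteEdge {m = suc m} G e = record
  { ends     = λ f → ends G (punchIn e f)
  ; loopless = λ f → loopless G (punchIn e f) }

open import Data.Nat using (_≤_; _<_)

Matchable : ∀ {n m} → ℕ → Graph n m → Set
Matchable k G = k ≤ numPM G

MinimallyMatchable : ∀ {n m} → ℕ → Graph n m → Set
MinimallyMatchable {m = m} k G =
  Matchable k G × (∀ (e : Fin m) → numPM (deleteEdge G e) < k)

-- Double counting.  Every perfect matching M of G avoids exactly d − 1 of the
-- d edges at x, so (d − 1)·|𝔐(G)| counts the pairs (M, e) with e ∋ x and
-- e ∉ M.  For a fixed e these are the perfect matchings of G − e, of which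
-- there are at most k − 1 by minimality; hence (d − 1)·|𝔐(G)| ≤ d·(k − 1).
-- Both corollaries are arithmetic: d ≥ 2 gives |𝔐(G)| ≤ 2k − 2, and
-- |𝔐(G)| ≥ k forces every degree to be at most k.
module Submission where

open import Defs
open import Data.Nat using (ℕ; _≤_; _*_; _∸_; _+_)
open import Data.Fin using (Fin)
open import Data.Product using (_×_)

open import Data.Bool.Base using (Bool; true; false; _∧_; not)
open import Data.Fin.Base using (zero; suc; punchIn)
open import Data.Fin.Subset using (Subset; ∣_∣; _∩_)
open import Data.List.Base as List using (List; filter; length; map)
open import Data.List.Properties using (filter-++; length-++)
open import Data.Nat.Base using (zero; suc; z≤n; s≤s)
open import Data.Nat.Properties
open import Data.Product.Base using (_,_; proj₁)
open import Data.Vec.Base using ([]; _∷_; lookup; insertAt)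
open import Data.Vec.Properties using (lookup∘tabulate; lookup-zipWith; insertAt-lookup; insertAt-punchIn)
open import Function.Base using (_∘_)
open import Function.Bundles using (mk⇔)
open import Relation.Nullary.Decidable using (Dec; yes; no; does; does-⇔)
open import Relation.Unary using (Pred; Decidable)
open import Relation.Binary.PropositionalEquality
open import Algebra.Properties.Semiring.Sum +-*-semiring
  using (sum; sum-syntax; sum-cong-≗; sum-remove; ∑-distrib-+; *-distribˡ-sum)
open import Algebra.Properties.CommutativeSemigroup +-commutativeSemigroup
  using (interchange)

boolToℕ : Bool → ℕ
boolToℕ true  = 1
boolToℕ false = 0

boolToℕ-∧ : ∀ a b → boolToℕ (a ∧ b) ≡ boolToℕ a * boolToℕ b
boolToℕ-∧ true  b = sym (+-identityʳ (boolToℕ b))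
boolToℕ-∧ false b = refl

boolToℕ-not+boolToℕ : ∀ b → boolToℕ (not b) + boolToℕ b ≡ 1
boolToℕ-not+boolToℕ true  = refl
boolToℕ-not+boolToℕ false = refl

boolToℕ-does-*-cong : ∀ {p} {P : Set p} (P? : Dec P) {a b : ℕ} →
  (P → a ≡ b) → boolToℕ (does P?) * a ≡ boolToℕ (does P?) * b
boolToℕ-does-*-cong (yes p) a≡b = cong (1 *_) (a≡b p)
boolToℕ-does-*-cong (no  _) a≡b = refl

sum-mono-≤ : ∀ {n} {f g : Fin n → ℕ} → (∀ i → f i ≤ g i) → sum f ≤ sum g
sum-mono-≤ {zero}  f≤g = z≤n
sum-mono-≤ {suc n} f≤g = +-mono-≤ (f≤g zero) (sum-mono-≤ (f≤g ∘ suc))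

∣p∣≡sum : ∀ {n} (p : Subset n) → ∣ p ∣ ≡ ∑[ i < n ] boolToℕ (lookup p i)
∣p∣≡sum []          = refl
∣p∣≡sum (true ∷ p)  = cong suc (∣p∣≡sum p)
∣p∣≡sum (false ∷ p) = ∣p∣≡sum p

∣p∩q∣≡sum : ∀ {n} (p q : Subset n) →
  ∣ p ∩ q ∣ ≡ ∑[ i < n ] (boolToℕ (lookup p i) * boolToℕ (lookup q i))
∣p∩q∣≡sum p q = trans (∣p∣≡sum (p ∩ q)) (sum-cong-≗ λ i →
  trans (cong boolToℕ (lookup-zipWith _∧_ i p q)) (boolToℕ-∧ (lookup p i) (lookup q i)))

sumSubsets : ∀ m → (Subset m → ℕ) → ℕ
sumSubsets zero    f = f []
sumSubsets (suc m) f = sumSubsets m (f ∘ (true ∷_)) + sumSubsets m (f ∘ (false ∷_))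

sumSubsets-cong : ∀ m {f g : Subset m → ℕ} → (∀ S → f S ≡ g S) → sumSubsets m f ≡ sumSubsets m g
sumSubsets-cong zero    f≗g = f≗g []
sumSubsets-cong (suc m) f≗g =
  cong₂ _+_ (sumSubsets-cong m (f≗g ∘ (true ∷_))) (sumSubsets-cong m (f≗g ∘ (false ∷_)))

sumSubsets-zero : ∀ m → sumSubsets m (λ _ → 0) ≡ 0
sumSubsets-zero zero    = refl
sumSubsets-zero (suc m) = cong₂ _+_ (sumSubsets-zero m) (sumSubsets-zero m)

sumSubsets-distrib-+ : ∀ m (f g : Subset m → ℕ) →
  sumSubsets m (λ S → f S + g S) ≡ sumSubsets m f + sumSubsets m g
sumSubsets-distrib-+ zero    f g = refl
sumSubsets-distrib-+ (suc m) f g =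
  trans (cong₂ _+_ (sumSubsets-distrib-+ m _ _) (sumSubsets-distrib-+ m _ _))
        (interchange (sumSubsets m (f ∘ (true ∷_))) (sumSubsets m (g ∘ (true ∷_)))
                     (sumSubsets m (f ∘ (false ∷_))) (sumSubsets m (g ∘ (false ∷_))))

*-distribʳ-sumSubsets : ∀ m c (f : Subset m → ℕ) →
  sumSubsets m f * c ≡ sumSubsets m (λ S → f S * c)
*-distribʳ-sumSubsets zero    c f = refl
*-distribʳ-sumSubsets (suc m) c f =
  trans (*-distribʳ-+ c (sumSubsets m _) _)
        (cong₂ _+_ (*-distribʳ-sumSubsets m c _) (*-distribʳ-sumSubsets m c _))

sum-sumSubsets-comm : ∀ n m (f : Fin n → Subset m → ℕ) →
  ∑[ i < n ] sumSubsets m (f i) ≡ sumSubsets m (λ S → ∑[ i < n ] f i S)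
sum-sumSubsets-comm zero    m f = sym (sumSubsets-zero m)
sum-sumSubsets-comm (suc n) m f =
  trans (cong (sumSubsets m (f zero) +_) (sum-sumSubsets-comm n m (f ∘ suc)))
        (sym (sumSubsets-distrib-+ m (f zero) _))

sumSubsets-insertAt : ∀ m (e : Fin (suc m)) (f : Subset (suc m) → ℕ) →
  sumSubsets (suc m) f ≡
  sumSubsets m (λ T → f (insertAt T e true)) + sumSubsets m (λ T → f (insertAt T e false))
sumSubsets-insertAt m       zero    f = refl
sumSubsets-insertAt (suc m) (suc e) f =
  trans (cong₂ _+_ (sumSubsets-insertAt m e (f ∘ (true ∷_))) (sumSubsets-insertAt m e (f ∘ (false ∷_))))
        (interchange (sumSubsets m (λ T → f (true ∷ insertAt T e true)))
                     (sumSubsets m (λ T → f (true ∷ insertAt T e false)))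
                     (sumSubsets m (λ T → f (false ∷ insertAt T e true)))
                     (sumSubsets m (λ T → f (false ∷ insertAt T e false))))

length-filter-allSubsets : ∀ {p} m {P : Pred (Subset m) p} (P? : Decidable P) →
  length (filter P? (allSubsets m)) ≡ sumSubsets m (boolToℕ ∘ does ∘ P?)
length-filter-allSubsets zero P? with does (P? [])
... | true  = refl
... | false = refl
length-filter-allSubsets (suc m) P? = begin
  length (filter P? (map (true ∷_) A List.++ map (false ∷_) A))
    ≡⟨ cong length (filter-++ P? (map (true ∷_) A) (map (false ∷_) A)) ⟩
  length (filter P? (map (true ∷_) A) List.++ filter P? (map (false ∷_) A))
    ≡⟨ length-++ (filter P? (map (true ∷_) A)) ⟩
  length (filter P? (map (true ∷_) A)) + length (filter P? (map (false ∷_) A))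
    ≡⟨ cong₂ _+_ (trans (length-filter-map (true ∷_) A) (length-filter-allSubsets m (P? ∘ (true ∷_))))
                 (trans (length-filter-map (false ∷_) A) (length-filter-allSubsets m (P? ∘ (false ∷_)))) ⟩
  sumSubsets (suc m) (boolToℕ ∘ does ∘ P?) ∎
  where
  open ≡-Reasoning
  A = allSubsets m
  length-filter-map : (f : Subset m → Subset (suc m)) (xs : List (Subset m)) →
    length (filter P? (map f xs)) ≡ length (filter (P? ∘ f) xs)
  length-filter-map f List.[] = refl
  length-filter-map f (x List.∷ xs) with does (P? (f x))
  ... | true  = cong suc (length-filter-map f xs)
  ... | false = length-filter-map f xs

pmIndicator : ∀ {n m} → Graph n m → Subset m → ℕ
pmIndicator G S = boolToℕ (does (isPerfectMatching? G S))

numPM≡sumSubsets : ∀ {n m} (G : Graph n m) → numPM G ≡ sumSubsets m (pmIndicator G)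
numPM≡sumSubsets {m = m} G = length-filter-allSubsets m (isPerfectMatching? G)

degree≡sum : ∀ {n m} (G : Graph n m) x → degree G x ≡ ∑[ e < m ] boolToℕ (isEnd G x e)
degree≡sum G x =
  trans (∣p∣≡sum (incident G x)) (sum-cong-≗ (cong boolToℕ ∘ lookup∘tabulate (isEnd G x)))

∣S∩incident∣≡sum : ∀ {n m} (G : Graph n m) (S : Subset m) x →
  ∣ S ∩ incident G x ∣ ≡ ∑[ e < m ] (boolToℕ (lookup S e) * boolToℕ (isEnd G x e))
∣S∩incident∣≡sum G S x = trans (∣p∩q∣≡sum S (incident G x)) (sum-cong-≗ λ e →
  cong (λ b → boolToℕ (lookup S e) * boolToℕ b) (lookup∘tabulate (isEnd G x) e))

avoidedEdges+1≡degree : ∀ {n m} (G : Graph n m) (S : Subset m) x → IsPerfectMatching G S →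
  ∑[ e < m ] (boolToℕ (not (lookup S e)) * boolToℕ (isEnd G x e)) + 1 ≡ degree G x
avoidedEdges+1≡degree {m = m} G S x isPM = begin
  ∑[ e < m ] (s̄ e * a e) + 1
    ≡⟨ cong (∑[ e < m ] (s̄ e * a e) +_) (trans (sym (isPM x)) (∣S∩incident∣≡sum G S x)) ⟩
  ∑[ e < m ] (s̄ e * a e) + ∑[ e < m ] (s e * a e)
    ≡⟨ ∑-distrib-+ (λ e → s̄ e * a e) (λ e → s e * a e) ⟨
  ∑[ e < m ] (s̄ e * a e + s e * a e)
    ≡⟨ sum-cong-≗ (λ e → trans (sym (*-distribʳ-+ (a e) (s̄ e) (s e)))
                              (trans (cong (_* a e) (boolToℕ-not+boolToℕ (lookup S e))) (*-identityˡ (a e)))) ⟩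
  ∑[ e < m ] a e
    ≡⟨ degree≡sum G x ⟨
  degree G x ∎
  where
  open ≡-Reasoning
  s s̄ a : Fin m → ℕ
  s e = boolToℕ (lookup S e)
  s̄ e = boolToℕ (not (lookup S e))
  a e = boolToℕ (isEnd G x e)

∣insertAt-false∩incident∣ : ∀ {n m} (G : Graph n (suc m)) e (T : Subset m) v →
  ∣ insertAt T e false ∩ incident G v ∣ ≡ ∣ T ∩ incident (deleteEdge G e) v ∣
∣insertAt-false∩incident∣ {m = m} G e T v = begin
  ∣ insertAt T e false ∩ incident G v ∣
    ≡⟨ ∣S∩incident∣≡sum G (insertAt T e false) v ⟩
  sum F
    ≡⟨ sum-remove F ⟩
  F e + ∑[ j < m ] F (punchIn e j)
    ≡⟨ cong₂ _+_ (cong (λ b → boolToℕ b * boolToℕ (isEnd G v e)) (insertAt-lookup T e false))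
                 (sum-cong-≗ λ j → cong (λ b → boolToℕ b * boolToℕ (isEnd G v (punchIn e j)))
                                        (insertAt-punchIn T e false j)) ⟩
  ∑[ j < m ] (boolToℕ (lookup T j) * boolToℕ (isEnd (deleteEdge G e) v j))
    ≡⟨ ∣S∩incident∣≡sum (deleteEdge G e) T v ⟨
  ∣ T ∩ incident (deleteEdge G e) v ∣ ∎
  where
  open ≡-Reasoning
  F : Fin (suc m) → ℕ
  F i = boolToℕ (lookup (insertAt T e false) i) * boolToℕ (isEnd G v i)

pmIndicator-insertAt-false : ∀ {n m} (G : Graph n (suc m)) e (T : Subset m) →
  pmIndicator G (insertAt T e false) ≡ pmIndicator (deleteEdge G e) T
pmIndicator-insertAt-false G e T = cong boolToℕ (does-⇔
  (mk⇔ (λ isPM v → trans (sym (∣insertAt-false∩incident∣ G e T v)) (isPM v))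
       (λ isPM v → trans (∣insertAt-false∩incident∣ G e T v) (isPM v)))
  (isPerfectMatching? G (insertAt T e false)) (isPerfectMatching? (deleteEdge G e) T))

numPM-deleteEdge : ∀ {n m} (G : Graph n (suc m)) e →
  numPM (deleteEdge G e) ≡ sumSubsets (suc m) (λ S → pmIndicator G S * boolToℕ (not (lookup S e)))
numPM-deleteEdge {m = m} G e = begin
  numPM (deleteEdge G e)
    ≡⟨ numPM≡sumSubsets (deleteEdge G e) ⟩
  sumSubsets m (pmIndicator (deleteEdge G e))
    ≡⟨ sumSubsets-cong m avoiding-false ⟨
  sumSubsets m (avoiding ∘ λ T → insertAt T e false)
    ≡⟨ cong (_+ sumSubsets m (avoiding ∘ λ T → insertAt T e false))
            (trans (sumSubsets-cong m avoiding-true) (sumSubsets-zero m)) ⟨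
  sumSubsets m (avoiding ∘ λ T → insertAt T e true) + sumSubsets m (avoiding ∘ λ T → insertAt T e false)
    ≡⟨ sumSubsets-insertAt m e avoiding ⟨
  sumSubsets (suc m) avoiding ∎
  where
  open ≡-Reasoning
  avoiding : Subset (suc m) → ℕ
  avoiding S = pmIndicator G S * boolToℕ (not (lookup S e))
  avoiding-true : ∀ T → avoiding (insertAt T e true) ≡ 0
  avoiding-true T = trans (cong (λ b → pmIndicator G (insertAt T e true) * boolToℕ (not b))
                                (insertAt-lookup T e true))
                          (*-zeroʳ (pmIndicator G (insertAt T e true)))
  avoiding-false : ∀ T → avoiding (insertAt T e false) ≡ pmIndicator (deleteEdge G e) T
  avoiding-false T = trans (cong (λ b → pmIndicator G (insertAt T e false) * boolToℕ (not b))
                                 (insertAt-lookup T e false))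
                           (trans (*-identityʳ _) (pmIndicator-insertAt-false G e T))

minimallyMatchable⇒numPM[G-e]≤k∸1 : ∀ {n m} k (G : Graph n m) → MinimallyMatchable k G → (e : Fin m) →
  sumSubsets m (λ S → pmIndicator G S * boolToℕ (not (lookup S e))) ≤ k ∸ 1
minimallyMatchable⇒numPM[G-e]≤k∸1 {m = suc m} k G (_ , minimal) e =
  subst (_≤ k ∸ 1) (numPM-deleteEdge G e) (<⇒≤pred (minimal e))

pmIndicator*[d∸1]≡sum : ∀ {n m} (G : Graph n m) x (S : Subset m) →
  pmIndicator G S * (degree G x ∸ 1) ≡
  ∑[ e < m ] (pmIndicator G S * boolToℕ (not (lookup S e)) * boolToℕ (isEnd G x e))
pmIndicator*[d∸1]≡sum {m = m} G x S = begin
  pmIndicator G S * (degree G x ∸ 1)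
    ≡⟨ boolToℕ-does-*-cong (isPerfectMatching? G S) avoided≡d∸1 ⟨
  pmIndicator G S * avoided
    ≡⟨ *-distribˡ-sum (pmIndicator G S) (λ e → s̄ e * a e) ⟩
  ∑[ e < m ] (pmIndicator G S * (s̄ e * a e))
    ≡⟨ sum-cong-≗ (λ e → *-assoc (pmIndicator G S) (s̄ e) (a e)) ⟨
  ∑[ e < m ] (pmIndicator G S * s̄ e * a e) ∎
  where
  open ≡-Reasoning
  s̄ a : Fin m → ℕ
  s̄ e = boolToℕ (not (lookup S e))
  a e = boolToℕ (isEnd G x e)
  avoided : ℕ
  avoided = ∑[ e < m ] (s̄ e * a e)
  avoided≡d∸1 : IsPerfectMatching G S → avoided ≡ degree G x ∸ 1
  avoided≡d∸1 isPM = trans (sym (m+n∸n≡m avoided 1)) (cong (_∸ 1) (avoidedEdges+1≡degree G S x isPM))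

[d∸1]*numPM≤d*[k∸1] : ∀ {n m} k (G : Graph n m) x → MinimallyMatchable k G →
  (degree G x ∸ 1) * numPM G ≤ degree G x * (k ∸ 1)
[d∸1]*numPM≤d*[k∸1] {m = m} k G x minMatchable = begin
  (d ∸ 1) * numPM G
    ≡⟨ *-comm (d ∸ 1) (numPM G) ⟩
  numPM G * (d ∸ 1)
    ≡⟨ cong (_* (d ∸ 1)) (numPM≡sumSubsets G) ⟩
  sumSubsets m (pmIndicator G) * (d ∸ 1)
    ≡⟨ *-distribʳ-sumSubsets m (d ∸ 1) (pmIndicator G) ⟩
  sumSubsets m (λ S → pmIndicator G S * (d ∸ 1))
    ≡⟨ sumSubsets-cong m (pmIndicator*[d∸1]≡sum G x) ⟩
  sumSubsets m (λ S → ∑[ e < m ] (avoiding e S * a e))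
    ≡⟨ sum-sumSubsets-comm m m (λ e S → avoiding e S * a e) ⟨
  ∑[ e < m ] sumSubsets m (λ S → avoiding e S * a e)
    ≡⟨ sum-cong-≗ (λ e → *-distribʳ-sumSubsets m (a e) (avoiding e)) ⟨
  ∑[ e < m ] (sumSubsets m (avoiding e) * a e)
    ≤⟨ sum-mono-≤ (λ e → *-monoˡ-≤ (a e) (minimallyMatchable⇒numPM[G-e]≤k∸1 k G minMatchable e)) ⟩
  ∑[ e < m ] ((k ∸ 1) * a e)
    ≡⟨ *-distribˡ-sum (k ∸ 1) a ⟨
  (k ∸ 1) * ∑[ e < m ] a e
    ≡⟨ cong ((k ∸ 1) *_) (degree≡sum G x) ⟨
  (k ∸ 1) * d
    ≡⟨ *-comm (k ∸ 1) d ⟩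
  d * (k ∸ 1) ∎
  where
  open ≤-Reasoning
  d : ℕ
  d = degree G x
  a : Fin m → ℕ
  a e = boolToℕ (isEnd G x e)
  avoiding : Fin m → Subset m → ℕ
  avoiding e S = pmIndicator G S * boolToℕ (not (lookup S e))

[d∸1]*M≤d*[k∸1]⇒M≤2*k∸2 : ∀ d k M → 2 ≤ d → (d ∸ 1) * M ≤ d * (k ∸ 1) → M ≤ 2 * k ∸ 2
[d∸1]*M≤d*[k∸1]⇒M≤2*k∸2 (suc (suc a)) k M (s≤s (s≤s z≤n)) bound =
  subst (M ≤_) (*-distribˡ-∸ 2 k 1) (*-cancelˡ-≤ (suc a) (begin
    suc a * M               ≤⟨ bound ⟩
    suc (suc a) * (k ∸ 1)   ≤⟨ *-monoˡ-≤ (k ∸ 1) (s≤s (s≤s (m≤m*n a 2))) ⟩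
    suc a * 2 * (k ∸ 1)     ≡⟨ *-assoc (suc a) 2 (k ∸ 1) ⟩
    suc a * (2 * (k ∸ 1))   ∎))
  where open ≤-Reasoning

[d∸1]*M≤d*[k∸1]⇒d≤k : ∀ d k M → 1 ≤ k → k ≤ M → (d ∸ 1) * M ≤ d * (k ∸ 1) → d ≤ k
[d∸1]*M≤d*[k∸1]⇒d≤k zero    k       M _ _   _     = z≤n
[d∸1]*M≤d*[k∸1]⇒d≤k (suc a) (suc b) M _ k≤M bound = s≤s (+-cancelʳ-≤ (a * b) a b (begin
  a + a * b   ≡⟨ *-suc a b ⟨
  a * suc b   ≤⟨ *-monoʳ-≤ a k≤M ⟩
  a * M       ≤⟨ bound ⟩
  b + a * b   ∎))
  where open ≤-Reasoning

lemma1 : ∀ {n m : ℕ} (k : ℕ) (G : Graph n m) (x : Fin n) →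
    1 ≤ k → MinimallyMatchable k G → 2 ≤ degree G x →
    ((degree G x ∸ 1) * numPM G ≤ degree G x * (k ∸ 1))
    × (numPM G ≤ 2 * k ∸ 2)
    × (∀ (y : Fin n) → degree G y ≤ k)
lemma1 k G x 1≤k minMatchable 2≤d =
    [d∸1]*numPM≤d*[k∸1] k G x minMatchable
  , [d∸1]*M≤d*[k∸1]⇒M≤2*k∸2 (degree G x) k (numPM G) 2≤d ([d∸1]*numPM≤d*[k∸1] k G x minMatchable)
  , λ y → [d∸1]*M≤d*[k∸1]⇒d≤k (degree G y) k (numPM G) 1≤k (proj₁ minMatchable)
            ([d∸1]*numPM≤d*[k∸1] k G y minMatchable)
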